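{- Let $p\in\mathbb N$ and consider a state $(w,S,v)$ with $w\in V_r$, $S\subseteq V_d$, $|S|\ge1$, $v\in S\cup V_r$. Let $m:=\min\{j:v_j\in S\}$ and $M:=\max\{j:v_j\in S\}$. Then $(w,S,v)$ is $\mathcal N_{BS-R}$-valid if and only if: - in case $v\in V_r$: $v_l\in S$ for all $l\in[m+p,M-p]$; - in case $v=v_i\in S$: $v_l\in S$ for all $l\in[m+p,M-p]$, and $i>l-p$ for all $v_l\in S$.
   Context: Setting: $V_d=\{v_1,\dots,v_{n_d}\}$ destinations, $V_r$ replenishment locations (RLs) containing $w_0,w_t$. An operation is $wsw'=(w,v_{O1},\dots,v_{Ok},w')$ with $w,w'\in V_r$, $k\ge1$, distinct destinations; $\{s\}$ its destination set. A drone tour is an alternating sequence of recharging legs (pairs of RLs) and operations, from $w_0$ to $w_t$, consecutive pieces connected, visiting each destination exactly once (no energy constraint imposed here); $\pi_d(V_d)$ is the visiting order of destinations. For $x=(v_1,\dots,v_{n_d})$ and a permutation $\sigma$ of $[n_d]$ ($\sigma(i)$ = new position of $v_i$), $(v_{\sigma^{ -1}(1)},\dots,v_{\sigma^{ -1}(n_d)})\in\mathcal N_{BS}(x,p)$ iff $\sigma(i)<\sigma(j)$ whenever $i+p\le j$. $\mathcal N_{BS-R}(x,p)$ is the set of drone tours with $\pi_d(V_d)\in\mathcal N_{BS}(x,p)$; an operation is $\mathcal N_{BS-R}$-valid if it occurs in some drone tour of $\mathcal N_{BS-R}(x,p)$. A state $(w,S,w')$ with $w'\in V_r$, $S\neq\emptyset$,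 is $\mathcal N_{BS-R}$-valid iff some valid operation $wsw'$ has $\{s\}=S$; a state $(w,S,v)$ with $v\in S$ is $\mathcal N_{BS-R}$-valid iff some valid operation $wsw''$ ($w''\in V_r$) with $\{s\}=S$ has $s$ ending in $v$. $[a,b]=\{a,\dots,b\}$ (empty if $a>b$). -}

module Defs where

open import Data.Nat using (ℕ; zero; suc; _+_; _≤_; _<_)
open import Data.Fin using (Fin; toℕ)
open import Data.Fin.Subset using (Subset; _∈_)
open import Data.List using (List; []; _∷_; _++_; concatMap; tabulate; last)
open import Data.List.Membership.Propositional renaming (_∈_ to _∈ˡ_)
open import Data.List.Relation.Unary.Unique.Propositional using (Unique)
open import Data.Maybe using (just)
open import Data.Product using (Σ; ∃; ∃-syntax; _×_; _,_)
open import Data.Sum using (_⊎_; inj₁; inj₂)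
open import Data.Empty using (⊥)
open import Data.Unit using (⊤)
open import Function.Bundles using (_↔_; Inverse)
open import Relation.Binary.PropositionalEquality using (_≡_)

-- Destinations V_d = {v_1,…,v_n} are represented by Fin n (v_{i+1} ↦ i, 0-based).
-- Replenishment locations V_r are an arbitrary type R (disjoint from V_d),
-- with distinguished elements w₀ and w_t.

record Operation (n : ℕ) (R : Set) : Set where
  constructor op
  field
    start    : R
    seq      : List (Fin n)
    finish   : R

WellFormedOp : ∀ {n R} → Operation n R → Set
WellFormedOp (op w [] w') = ⊥
WellFormedOp (op w (x ∷ s) w') = Unique (x ∷ s)

-- Pieces of a drone tour: recharging legs (pairs of RLs) and operations.
data Piece (n : ℕ) (R : Set) : Set where
  leg  : R → R → Piece n R
  oper : Operation n R → Piece n R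

pStart : ∀ {n R} → Piece n R → R
pStart (leg w w') = w
pStart (oper o) = Operation.start o

pEnd : ∀ {n R} → Piece n R → R
pEnd (leg w w') = w'
pEnd (oper o) = Operation.finish o

isLeg : ∀ {n R} → Piece n R → Set
isLeg (leg _ _) = ⊤
isLeg (oper _) = ⊥

isOp : ∀ {n R} → Piece n R → Set
isOp (leg _ _) = ⊥
isOp (oper _) = ⊤

AltConn : ∀ {n R} → List (Piece n R) → Set
AltConn [] = ⊤
AltConn (x ∷ []) = ⊤
AltConn (x ∷ y ∷ ps) =
  ((isLeg x × isOp y) ⊎ (isOp x × isLeg y)) × pEnd x ≡ pStart y × AltConn (y ∷ ps)

AllOpsWF : ∀ {n R} → List (Piece n R) → Set
AllOpsWF [] = ⊤
AllOpsWF (leg _ _ ∷ ps) = AllOpsWF ps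
AllOpsWF (oper o ∷ ps) = WellFormedOp o × AllOpsWF ps

StartsAt : ∀ {n R} → R → List (Piece n R) → Set
StartsAt w [] = ⊥
StartsAt w (x ∷ _) = pStart x ≡ w

EndsAt : ∀ {n R} → R → List (Piece n R) → Set
EndsAt w ps with last ps
... | just x = pEnd x ≡ w
... | _ = ⊥

πd : ∀ {n R} → List (Piece n R) → List (Fin n)
πd = concatMap f
  where
  f : ∀ {n R} → Piece n R → List (Fin _)
  f (leg _ _) = []
  f (oper o) = Operation.seq o

-- A drone tour from w₀ to w_t (no energy constraint)
DroneTour : ∀ {n R} → R → R → List (Piece n R) → Set
DroneTour {n} w₀ wₜ ps =
  StartsAt w₀ ps × EndsAt wₜ ps × AltConn ps × AllOpsWF ps ×
  Unique (πd ps) × (∀ (d : Fin n) → d ∈ˡ πd ps)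

-- N_BS(x,p) with x = (v_1,…,v_n): σ(i) is the new position of v_i.
InNBS : (n p : ℕ) → List (Fin n) → Set
InNBS n p y = Σ (Fin n ↔ Fin n) λ σ →
  (y ≡ tabulate (Inverse.from σ)) ×
  (∀ (i j : Fin n) → toℕ i + p ≤ toℕ j → toℕ (Inverse.to σ i) < toℕ (Inverse.to σ j))

InNBSR : ∀ {n R} → (p : ℕ) → R → R → List (Piece n R) → Set
InNBSR {n} p w₀ wₜ ps = DroneTour w₀ wₜ ps × InNBS n p (πd ps)

ValidOp : ∀ {n R} → (p : ℕ) → R → R → Operation n R → Set
ValidOp {n} {R} p w₀ wₜ o = Σ (List (Piece n R)) λ ps → InNBSR p w₀ wₜ ps × oper o ∈ˡ ps

SeqSet : ∀ {n} → List (Fin n) → Subset n → Set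
SeqSet {n} s S = ∀ (d : Fin n) → (d ∈ˡ s → d ∈ S) × (d ∈ S → d ∈ˡ s)

ValidState : ∀ {n R} → (p : ℕ) → R → R → R → Subset n → Fin n ⊎ R → Set
ValidState {n} {R} p w₀ wₜ w S (inj₂ w') =
  Σ (List (Fin n)) λ s → ValidOp p w₀ wₜ (op w s w') × SeqSet s S
ValidState {n} {R} p w₀ wₜ w S (inj₁ v) =
  Σ R λ w'' → Σ (List (Fin n)) λ s →
    ValidOp p w₀ wₜ (op w s w'') × SeqSet s S × last s ≡ just v

IsMinOf : ∀ {n} → Fin n → Subset n → Set
IsMinOf {n} m S = m ∈ S × (∀ (j : Fin n) → j ∈ S → toℕ m ≤ toℕ j)

IsMaxOf : ∀ {n} → Fin n → Subset n → Set
IsMaxOf {n} M S = M ∈ S × (∀ (j : Fin n) → j ∈ S → toℕ j ≤ toℕ M)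

IntervalCond : ∀ {n} → ℕ → Fin n → Fin n → Subset n → Set
IntervalCond {n} p m M S =
  ∀ (l : Fin n) → toℕ m + p ≤ toℕ l → toℕ l + p ≤ toℕ M → l ∈ S

Criterion : ∀ {n} {R : Set} → ℕ → Fin n → Fin n → Subset n → Fin n ⊎ R → Set
Criterion p m M S (inj₂ _) = IntervalCond p m M S
Criterion {n} p m M S (inj₁ i) =
  IntervalCond p m M S × (∀ (l : Fin n) → l ∈ S → toℕ l < toℕ i + p)

InSOrR : ∀ {n} {R : Set} → Subset n → Fin n ⊎ R → Set
InSOrR S (inj₁ v) = v ∈ S
InSOrR S (inj₂ _) = ⊤

-- An operation of a tour is a contiguous block of its visiting order, so for a valid state the
-- set S fills an interval of positions of a permutation σ with σ(i) < σ(j) whenever i + p ≤ j.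
-- Every l with m + p ≤ l ≤ M - p lies strictly between v_m and v_M in that order, hence in S; and
-- no l ∈ S may be forced after the last destination v_i of the block, i.e. l < i + p.
-- Conversely, under these conditions order the destinations in three slots: those outside S with
-- l + p ≤ M, then S, then the rest, keeping the index order within each slot except that v_i goes
-- last in S. This order lies in N_BS(x, p), and S is a segment of it ending in v_i; a tour serving
-- the three slots by separate operations realises it. The case v ∈ V_r is the case v = v_M.

module Submission where

open import Defs
open import Data.Nat using (ℕ; zero; suc; _+_; _*_; _∸_; _≤_; _<_; z≤n; s≤s; _<?_; _≤?_)
open import Data.Nat.Properties hiding (_≟_)
open import Data.Fin using (Fin; toℕ; fromℕ<; punchOut; _≟_) renaming (zero to fzero; suc to fsuc)
open import Data.Fin.Properties using (toℕ-fromℕ<; toℕ<n; toℕ-injective; punchOut-injective; injective⇒≤; any?)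
open import Data.Fin.Subset using (Subset; Nonempty; _∈_)
open import Data.Fin.Subset.Properties using (_∈?_)
open import Data.List using (List; []; _∷_; _++_; length; tabulate; allFin; filter; take; drop; last)
open import Data.List.Properties
  using (length-tabulate; length-filter; length-take; length-drop; take++drop≡id; ++-assoc; ++-identityʳ)
open import Data.List.Membership.Propositional using () renaming (_∈_ to _∈ˡ_)
open import Data.List.Membership.Propositional.Properties using (∈-tabulate⁺; ∈-∃++)
import Data.List.Relation.Unary.Any as Any
open import Data.List.Relation.Unary.All.Properties using () renaming (++⁻ˡ to All-++⁻ˡ)
open import Data.List.Relation.Unary.AllPairs using (_∷_; [])
open import Data.List.Relation.Unary.Unique.Propositional using (Unique)
open import Data.List.Relation.Unary.Unique.Propositional.Properties using (tabulate⁺)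
open import Data.Maybe using (just)
open import Data.Product using (∃-syntax; _×_; _,_; proj₁; proj₂; uncurry)
open import Data.Product.Function.NonDependent.Propositional using (_×-⇔_)
open import Data.Sum using (_⊎_; inj₁; inj₂)
open import Function using (_∘_; id; Injective)
open import Function.Bundles using (_↔_; Inverse; mk↔ₛ′; _⇔_; mk⇔; Equivalence)
open import Function.Construct.Composition using (_⇔-∘_)
open import Function.Related.Propositional using (module EquationalReasoning)
open import Level using (0ℓ)
open import Relation.Binary using (tri<; tri≈; tri>)
open import Relation.Binary.PropositionalEquality
open import Relation.Nullary using (¬_; yes; no; contradiction)
open import Relation.Unary using (Pred; Decidable)

private
  variable
    A : Set
    n k : ℕ
    x y : A
    xs ys : List A

infix 4 _[_]=_

data _[_]=_ {A : Set} : List A → ℕ → A → Set where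
  here  : (x ∷ xs) [ 0 ]= x
  there : xs [ k ]= y → (x ∷ xs) [ suc k ]= y

[]=⇒∈ : xs [ k ]= x → x ∈ˡ xs
[]=⇒∈ here      = Any.here refl
[]=⇒∈ (there p) = Any.there ([]=⇒∈ p)

∈⇒[]= : x ∈ˡ xs → ∃[ k ] xs [ k ]= x
∈⇒[]= (Any.here refl) = 0 , here
∈⇒[]= (Any.there x∈xs) with k , p ← ∈⇒[]= x∈xs = suc k , there p

[]=⇒<length : xs [ k ]= x → k < length xs
[]=⇒<length here      = s≤s z≤n
[]=⇒<length (there p) = s≤s ([]=⇒<length p)

<length⇒[]= : k < length xs → ∃[ x ] xs [ k ]= x
<length⇒[]= {k = zero}  {xs = x ∷ xs} _ = x , here
<length⇒[]= {k = suc k} {xs = x ∷ xs} (s≤s k<n) with y , p ← <length⇒[]= k<n = y , there p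

[]=-++⁺ˡ : ∀ ys → xs [ k ]= x → (xs ++ ys) [ k ]= x
[]=-++⁺ˡ ys here      = here
[]=-++⁺ˡ ys (there p) = there ([]=-++⁺ˡ ys p)

[]=-++⁺ʳ : ∀ xs → ys [ k ]= x → (xs ++ ys) [ length xs + k ]= x
[]=-++⁺ʳ []       p = p
[]=-++⁺ʳ (_ ∷ xs) p = there ([]=-++⁺ʳ xs p)

[]=-++⁻ : ∀ xs → (xs ++ ys) [ k ]= x →
          (k < length xs × xs [ k ]= x) ⊎ ∃[ j ] (k ≡ length xs + j × ys [ j ]= x)
[]=-++⁻ []       p         = inj₂ (_ , refl , p)
[]=-++⁻ (_ ∷ xs) here      = inj₁ (s≤s z≤n , here)
[]=-++⁻ (_ ∷ xs) (there p) with []=-++⁻ xs p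
... | inj₁ (k<n , q)      = inj₁ (s≤s k<n , there q)
... | inj₂ (j , refl , q) = inj₂ (j , refl , q)

[]=-tabulate : (f : Fin n → A) (i : Fin n) → tabulate f [ toℕ i ]= f i
[]=-tabulate f fzero    = here
[]=-tabulate f (fsuc i) = there ([]=-tabulate (f ∘ fsuc) i)

tabulate-[]=⁻ : (f : Fin n → A) → tabulate f [ k ]= x → ∃[ i ] (toℕ i ≡ k × f i ≡ x)
tabulate-[]=⁻ {n = suc n} f here      = fzero , refl , refl
tabulate-[]=⁻ {n = suc n} f (there p) with i , refl , refl ← tabulate-[]=⁻ (f ∘ fsuc) p =
  fsuc i , refl , refl

[]=⇒last : xs [ k ]= x → suc k ≡ length xs → last xs ≡ just x
[]=⇒last {xs = _ ∷ []}    here      _  = refl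
[]=⇒last {xs = _ ∷ _ ∷ _} (there p) eq = []=⇒last p (suc-injective eq)

last⇒[]= : last xs ≡ just x → ∃[ k ] (suc k ≡ length xs × xs [ k ]= x)
last⇒[]= {xs = _ ∷ []}    refl = 0 , refl , here
last⇒[]= {xs = _ ∷ _ ∷ _} eq with k , len , p ← last⇒[]= eq = suc k , cong suc len , there p

[]=-maximal⇒last : xs [ k ]= x → (∀ {j y} → xs [ j ]= y → j ≤ k) → last xs ≡ just x
[]=-maximal⇒last {xs = xs} {k = k} p maximal = []=⇒last p (≤-antisym ([]=⇒<length p) length≤1+k)
  where
  length≤1+k : length xs ≤ suc k
  length≤1+k with suc k <? length xs
  ... | yes 1+k<len = contradiction (maximal (proj₂ (<length⇒[]= 1+k<len))) 1+n≰n
  ... | no  1+k≮len = ≮⇒≥ 1+k≮len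

splitRange : ∀ {a b} (xs : List A) → a ≤ b → b ≤ length xs →
  ∃[ pre ] ∃[ mid ] ∃[ post ] (xs ≡ pre ++ mid ++ post × length pre ≡ a × length pre + length mid ≡ b)
splitRange {a = a} {b} xs a≤b b≤len =
  take a xs , take (b ∸ a) rest , drop (b ∸ a) rest ,
  sym (trans (cong (take a xs ++_) (take++drop≡id (b ∸ a) rest)) (take++drop≡id a xs)) ,
  |pre| , trans (cong₂ _+_ |pre| |mid|) (m+[n∸m]≡n a≤b)
  where
  rest = drop a xs
  |pre| : length (take a xs) ≡ a
  |pre| = trans (length-take a xs) (m≤n⇒m⊓n≡m (≤-trans a≤b b≤len))
  |mid| : length (take (b ∸ a) rest) ≡ b ∸ a
  |mid| = trans (length-take (b ∸ a) rest)
    (m≤n⇒m⊓n≡m (subst (b ∸ a ≤_) (sym (length-drop a xs)) (∸-monoˡ-≤ a b≤len)))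

-- Sorting by an injective key

module _ {P Q : Pred A 0ℓ} (P? : Decidable P) (Q? : Decidable Q) (P⇒Q : ∀ {x} → P x → Q x) where

  length-filter-mono : ∀ xs → length (filter P? xs) ≤ length (filter Q? xs)
  length-filter-mono []       = z≤n
  length-filter-mono (x ∷ xs) with P? x | Q? x
  ... | yes _  | yes _  = s≤s (length-filter-mono xs)
  ... | yes px | no ¬qx = contradiction (P⇒Q px) ¬qx
  ... | no _   | yes _  = m≤n⇒m≤1+n (length-filter-mono xs)
  ... | no _   | no _   = length-filter-mono xs

  length-filter-mono-< : x ∈ˡ xs → ¬ P x → Q x → length (filter P? xs) < length (filter Q? xs)
  length-filter-mono-< {xs = x ∷ xs} (Any.here refl) ¬px qx with P? x | Q? x
  ... | yes px | _      = contradiction px ¬px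
  ... | no _   | yes _  = s≤s (length-filter-mono xs)
  ... | no _   | no ¬qx = contradiction qx ¬qx
  length-filter-mono-< {xs = y ∷ xs} (Any.there x∈xs) ¬px qx with P? y | Q? y
  ... | yes _  | yes _  = s≤s (length-filter-mono-< x∈xs ¬px qx)
  ... | yes py | no ¬qy = contradiction (P⇒Q py) ¬qy
  ... | no _   | yes _  = m≤n⇒m≤1+n (length-filter-mono-< x∈xs ¬px qx)
  ... | no _   | no _   = length-filter-mono-< x∈xs ¬px qx

injective⇒surjective : (f : Fin n → Fin n) → Injective _≡_ _≡_ f → ∀ j → ∃[ i ] f i ≡ j
injective⇒surjective {zero}  f f-inj ()
injective⇒surjective {suc n} f f-inj j with any? (λ i → f i ≟ j)
... | yes hit = hit
... | no miss = contradiction (injective⇒≤ punched-injective) (<-irrefl refl)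
  where
  f≢j : ∀ i → j ≢ f i
  f≢j i eq = miss (i , sym eq)
  punched-injective : Injective _≡_ _≡_ (λ i → punchOut (f≢j i))
  punched-injective {x} {y} eq = f-inj (punchOut-injective (f≢j x) (f≢j y) eq)

module SortByKey (key : Fin n → ℕ) (key-injective : Injective _≡_ _≡_ key) where

  below : ℕ → ℕ
  below t = length (filter (λ e → key e <? t) (allFin n))

  rank : Fin n → ℕ
  rank d = below (key d)

  below≤n : ∀ t → below t ≤ n
  below≤n t = ≤-trans (length-filter _ (allFin n)) (≤-reflexive (length-tabulate _))

  below-mono : ∀ {s t} → s ≤ t → below s ≤ below t
  below-mono s≤t = length-filter-mono _ _ (λ ks → <-≤-trans ks s≤t) (allFin n)

  rank<below : ∀ {d t} → key d < t → rank d < below t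
  rank<below {d} kd<t = length-filter-mono-< _ _ (λ k<kd → <-trans k<kd kd<t)
    (∈-tabulate⁺ d) (<-irrefl refl) kd<t

  rank<below⇔ : ∀ {d t} → rank d < below t ⇔ key d < t
  rank<below⇔ {d} {t} = mk⇔ to rank<below
    where
    to : rank d < below t → key d < t
    to r<b with key d <? t
    ... | yes kd<t = kd<t
    ... | no kd≮t  = contradiction (below-mono (≮⇒≥ kd≮t)) (<⇒≱ r<b)

  below≤rank⇔ : ∀ {d t} → below t ≤ rank d ⇔ t ≤ key d
  below≤rank⇔ {d} {t} = mk⇔ to below-mono
    where
    to : below t ≤ rank d → t ≤ key d
    to b≤r with t ≤? key d
    ... | yes t≤kd = t≤kd
    ... | no t≰kd  = contradiction (rank<below (≰⇒> t≰kd)) (≤⇒≯ b≤r)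

  rank-injective : Injective _≡_ _≡_ rank
  rank-injective {d} {e} eq with <-cmp (key d) (key e)
  ... | tri< kd<ke _ _ = contradiction eq (<⇒≢ (rank<below kd<ke))
  ... | tri≈ _ kd≡ke _ = key-injective kd≡ke
  ... | tri> _ _ ke<kd = contradiction (sym eq) (<⇒≢ (rank<below ke<kd))

  toRank : Fin n → Fin n
  toRank d = fromℕ< (<-≤-trans (rank<below (n<1+n (key d))) (below≤n _))

  toℕ-toRank : ∀ d → toℕ (toRank d) ≡ rank d
  toℕ-toRank d = toℕ-fromℕ< _

  toRank-injective : Injective _≡_ _≡_ toRank
  toRank-injective {d} {e} eq =
    rank-injective (trans (sym (toℕ-toRank d)) (trans (cong toℕ eq) (toℕ-toRank e)))

  σ : Fin n ↔ Fin n
  σ = mk↔ₛ′ toRank (proj₁ ∘ surj) (proj₂ ∘ surj) (λ d → toRank-injective (proj₂ (surj (toRank d))))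
    where
    surj : ∀ j → ∃[ d ] toRank d ≡ j
    surj = injective⇒surjective toRank toRank-injective

module Enumeration (σ : Fin n ↔ Fin n) where

  open Inverse σ

  enum : List (Fin n)
  enum = tabulate from

  pos : Fin n → ℕ
  pos d = toℕ (to d)

  from-injective : Injective _≡_ _≡_ from
  from-injective {x} {y} eq = trans (sym (strictlyInverseˡ x)) (trans (cong to eq) (strictlyInverseˡ y))

  enum[pos] : ∀ d → enum [ pos d ]= d
  enum[pos] d = subst (enum [ pos d ]=_) (strictlyInverseʳ d) ([]=-tabulate from (to d))

  enum[]=⇒pos : enum [ k ]= x → pos x ≡ k
  enum[]=⇒pos p with i , refl , refl ← tabulate-[]=⁻ from p = cong toℕ (strictlyInverseˡ i)

  enum-unique : Unique enum
  enum-unique = tabulate⁺ from-injective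

  ∈-enum : ∀ d → d ∈ˡ enum
  ∈-enum d = subst (_∈ˡ enum) (strictlyInverseʳ d) (∈-tabulate⁺ (to d))

  module Segment {pre mid post : List (Fin n)} (split : enum ≡ pre ++ mid ++ post) where

    pos-mid : mid [ k ]= x → pos x ≡ length pre + k
    pos-mid p = enum[]=⇒pos (subst (_[ _ ]= _) (sym split) ([]=-++⁺ʳ pre ([]=-++⁺ˡ post p)))

    ∈-mid⇒pos∈range : ∀ {d} → d ∈ˡ mid → length pre ≤ pos d × pos d < length pre + length mid
    ∈-mid⇒pos∈range d∈mid with k , p ← ∈⇒[]= d∈mid rewrite pos-mid p =
      m≤m+n _ k , +-monoʳ-< (length pre) ([]=⇒<length p)

    pos∈range⇒∈-mid : ∀ {d} → length pre ≤ pos d → pos d < length pre + length mid → d ∈ˡ mid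
    pos∈range⇒∈-mid {d} a≤pos pos<b with []=-++⁻ pre (subst (_[ pos d ]= d) split (enum[pos] d))
    ... | inj₁ (pos<a , _) = contradiction a≤pos (<⇒≱ pos<a)
    ... | inj₂ (j , pos≡ , p) with []=-++⁻ mid p
    ...   | inj₁ (_ , q)         = []=⇒∈ q
    ...   | inj₂ (j' , refl , _) = contradiction pos<b (≤⇒≯ (begin
            length pre + length mid        ≤⟨ +-monoʳ-≤ (length pre) (m≤m+n (length mid) j') ⟩
            length pre + (length mid + j') ≡⟨ sym pos≡ ⟩
            pos d                          ∎))
      where open ≤-Reasoning

    last-mid⇒maximal : ∀ {d} → last mid ≡ just d → ∀ e → e ∈ˡ mid → pos e ≤ pos d
    last-mid⇒maximal {d} eq e e∈mid with k , len , p ← last⇒[]= eq = ≤-pred (begin-strict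
      pos e                   <⟨ proj₂ (∈-mid⇒pos∈range e∈mid) ⟩
      length pre + length mid ≡⟨ cong (length pre +_) (sym len) ⟩
      length pre + suc k      ≡⟨ +-suc (length pre) k ⟩
      suc (length pre + k)    ≡⟨ cong suc (sym (pos-mid p)) ⟩
      suc (pos d)             ∎)
      where open ≤-Reasoning

    maximal⇒last-mid : ∀ {d} → d ∈ˡ mid → (∀ e → e ∈ˡ mid → pos e ≤ pos d) → last mid ≡ just d
    maximal⇒last-mid {d} d∈mid maximal with k , p ← ∈⇒[]= d∈mid = []=-maximal⇒last p λ {j} {e} q →
      +-cancelˡ-≤ (length pre) j k (subst₂ _≤_ (pos-mid q) (pos-mid p) (maximal e ([]=⇒∈ q)))

-- Operations as segments of orders in N_BS(x, p)

BSOrder : ℕ → Fin n ↔ Fin n → Set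
BSOrder {n} p σ = ∀ (i j : Fin n) → toℕ i + p ≤ toℕ j → toℕ (Inverse.to σ i) < toℕ (Inverse.to σ j)

record BSSegment (n p : ℕ) (s : List (Fin n)) : Set where
  field
    σ        : Fin n ↔ Fin n
    bsOrder  : BSOrder p σ
    pre post : List (Fin n)
    split    : Enumeration.enum σ ≡ pre ++ s ++ post

πd-++ : ∀ {R} (ps qs : List (Piece n R)) → πd (ps ++ qs) ≡ πd ps ++ πd qs
πd-++ []                   qs = refl
πd-++ (leg _ _ ∷ ps)       qs = πd-++ ps qs
πd-++ (oper (op _ s _) ∷ ps) qs = trans (cong (s ++_) (πd-++ ps qs)) (sym (++-assoc s (πd ps) (πd qs)))

validOp⇒segment : ∀ {R p} {w₀ wₜ w w' : R} {s : List (Fin n)} →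
                  ValidOp p w₀ wₜ (op w s w') → BSSegment n p s
validOp⇒segment (_ , (_ , σ , πd≡enum , order) , o∈ps) with ps₁ , ps₂ , refl ← ∈-∃++ o∈ps = record
  { σ = σ ; bsOrder = order ; pre = πd ps₁ ; post = πd ps₂
  ; split = trans (sym πd≡enum) (πd-++ ps₁ _) }

unique-++⁻ : ∀ xs → Unique (xs ++ ys) → Unique xs × Unique ys
unique-++⁻ []       u         = [] , u
unique-++⁻ (x ∷ xs) (x∉ ∷ u) = (All-++⁻ˡ xs x∉ ∷ proj₁ (unique-++⁻ xs u)) , proj₂ (unique-++⁻ xs u)

module SegmentTour {n : ℕ} {R : Set} (w₀ wₜ w w' : R) where

  -- operations are nonempty, so an empty pre or post gets no operation of its own
  segmentTour : List (Fin n) → Fin n → List (Fin n) → List (Fin n) → List (Piece n R)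
  segmentTour []       y ys []       =
    leg w₀ w ∷ oper (op w (y ∷ ys) w') ∷ leg w' wₜ ∷ []
  segmentTour []       y ys (z ∷ zs) =
    leg w₀ w ∷ oper (op w (y ∷ ys) w') ∷ leg w' w' ∷ oper (op w' (z ∷ zs) w') ∷ leg w' wₜ ∷ []
  segmentTour (x ∷ xs) y ys []       =
    leg w₀ w ∷ oper (op w (x ∷ xs) w) ∷ leg w w ∷ oper (op w (y ∷ ys) w') ∷ leg w' wₜ ∷ []
  segmentTour (x ∷ xs) y ys (z ∷ zs) =
    leg w₀ w ∷ oper (op w (x ∷ xs) w) ∷ leg w w ∷ oper (op w (y ∷ ys) w') ∷
    leg w' w' ∷ oper (op w' (z ∷ zs) w') ∷ leg w' wₜ ∷ []

  πd-segmentTour : ∀ pre y ys post → πd (segmentTour pre y ys post) ≡ pre ++ (y ∷ ys) ++ post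
  πd-segmentTour []      y ys []       = refl
  πd-segmentTour []      y ys (z ∷ zs) = cong (λ t → y ∷ ys ++ z ∷ t) (++-identityʳ zs)
  πd-segmentTour (_ ∷ _) y ys []       = refl
  πd-segmentTour (x ∷ xs) y ys (z ∷ zs) = cong (λ t → x ∷ xs ++ y ∷ ys ++ z ∷ t) (++-identityʳ zs)

  segment∈segmentTour : ∀ pre y ys post → oper (op w (y ∷ ys) w') ∈ˡ segmentTour pre y ys post
  segment∈segmentTour []      y ys []      = Any.there (Any.here refl)
  segment∈segmentTour []      y ys (_ ∷ _) = Any.there (Any.here refl)
  segment∈segmentTour (_ ∷ _) y ys []      = Any.there (Any.there (Any.there (Any.here refl)))
  segment∈segmentTour (_ ∷ _) y ys (_ ∷ _) = Any.there (Any.there (Any.there (Any.here refl)))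

  segmentTour-wellFormed : ∀ pre y ys post → Unique pre → Unique (y ∷ ys) → Unique post →
    let T = segmentTour pre y ys post in StartsAt w₀ T × EndsAt wₜ T × AltConn T × AllOpsWF T
  segmentTour-wellFormed []      y ys []      _  u₂ _  =
    refl , refl , (inj₁ _ , refl , inj₂ _ , refl , _) , u₂ , _
  segmentTour-wellFormed []      y ys (_ ∷ _) _  u₂ u₃ =
    refl , refl , (inj₁ _ , refl , inj₂ _ , refl , inj₁ _ , refl , inj₂ _ , refl , _) , u₂ , u₃ , _
  segmentTour-wellFormed (_ ∷ _) y ys []      u₁ u₂ _  =
    refl , refl , (inj₁ _ , refl , inj₂ _ , refl , inj₁ _ , refl , inj₂ _ , refl , _) , u₁ , u₂ , _
  segmentTour-wellFormed (_ ∷ _) y ys (_ ∷ _) u₁ u₂ u₃ =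
    refl , refl , (inj₁ _ , refl , inj₂ _ , refl , inj₁ _ , refl , inj₂ _ , refl ,
                   inj₁ _ , refl , inj₂ _ , refl , _) , u₁ , u₂ , u₃ , _

  segmentTour-isDroneTour : ∀ pre y ys post → Unique (pre ++ (y ∷ ys) ++ post) →
    (∀ d → d ∈ˡ pre ++ (y ∷ ys) ++ post) → DroneTour w₀ wₜ (segmentTour pre y ys post)
  segmentTour-isDroneTour pre y ys post u complete =
    let u₁ , u₂₃ = unique-++⁻ pre u
        u₂ , u₃  = unique-++⁻ (y ∷ ys) u₂₃
        start , end , alt , wf = segmentTour-wellFormed pre y ys post u₁ u₂ u₃
    in start , end , alt , wf , subst Unique (sym πd≡) u , λ d → subst (d ∈ˡ_) (sym πd≡) (complete d)
    where
    πd≡ : πd (segmentTour pre y ys post) ≡ pre ++ (y ∷ ys) ++ post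
    πd≡ = πd-segmentTour pre y ys post

segment⇒validOp : ∀ {R p} (w₀ wₜ w w' : R) {s : List (Fin n)} {d} → BSSegment n p s → d ∈ˡ s →
                  ValidOp p w₀ wₜ (op w s w')
segment⇒validOp w₀ wₜ w w' {y ∷ ys} seg _ =
  segmentTour pre y ys post ,
  (segmentTour-isDroneTour pre y ys post (subst Unique split enum-unique) (λ d → subst (d ∈ˡ_) split (∈-enum d)) ,
   σ , trans (πd-segmentTour pre y ys post) (sym split) , bsOrder) ,
  segment∈segmentTour pre y ys post
  where
  open BSSegment seg
  open Enumeration σ
  open SegmentTour w₀ wₜ w w'

SpansSegment : ℕ → Subset n → Set
SpansSegment {n} p S = ∃[ s ] (BSSegment n p s × SeqSet s S)

SpansSegmentEndingIn : ℕ → Subset n → Fin n → Set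
SpansSegmentEndingIn {n} p S i = ∃[ s ] (BSSegment n p s × SeqSet s S × last s ≡ just i)

module _ {R : Set} {p : ℕ} {w₀ wₜ w : R} {S : Subset n} where

  validState⇔spansSegment : Nonempty S → ∀ {w'} → ValidState p w₀ wₜ w S (inj₂ w') ⇔ SpansSegment p S
  validState⇔spansSegment (d , d∈S) {w'} = mk⇔
    (λ (s , valid , s≈S) → s , validOp⇒segment valid , s≈S)
    (λ (s , seg , s≈S) → s , segment⇒validOp w₀ wₜ w w' seg (proj₂ (s≈S d) d∈S) , s≈S)

  validState⇔spansSegmentEndingIn : ∀ {i} → ValidState p w₀ wₜ w S (inj₁ i) ⇔ SpansSegmentEndingIn p S i
  validState⇔spansSegmentEndingIn = mk⇔
    (λ (_ , s , valid , s≈S , last≡i) → s , validOp⇒segment valid , s≈S , last≡i)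
    (λ (s , seg , s≈S , last≡i) →
      w , s , segment⇒validOp w₀ wₜ w w seg ([]=⇒∈ (proj₂ (proj₂ (last⇒[]= last≡i)))) , s≈S , last≡i)

-- Necessity

module _ {p : ℕ} {s : List (Fin n)} {S : Subset n} (seg : BSSegment n p s) (s≈S : SeqSet s S) where

  open BSSegment seg
  open Enumeration σ
  open Segment {pre} {s} {post} split

  segment⇒intervalCond : ∀ {m M} → m ∈ S → M ∈ S → IntervalCond p m M S
  segment⇒intervalCond {m} {M} m∈S M∈S l m+p≤l l+p≤M = proj₁ (s≈S l) (pos∈range⇒∈-mid
    (≤-trans (proj₁ (∈-mid⇒pos∈range (proj₂ (s≈S m) m∈S))) (<⇒≤ (bsOrder m l m+p≤l)))
    (<-trans (bsOrder l M l+p≤M) (proj₂ (∈-mid⇒pos∈range (proj₂ (s≈S M) M∈S)))))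

  segment⇒lastBound : ∀ {i} → last s ≡ just i → ∀ l → l ∈ S → toℕ l < toℕ i + p
  segment⇒lastBound {i} last≡i l l∈S with toℕ l <? toℕ i + p
  ... | yes l<i+p = l<i+p
  ... | no  l≮i+p = contradiction (last-mid⇒maximal last≡i l (proj₂ (s≈S l) l∈S))
                                  (<⇒≱ (bsOrder i l (≮⇒≥ l≮i+p)))

-- Sufficiency

module _ {N : ℕ} where

  lex-< : ∀ {g h s t} → g < h → s < N → g * N + s < h * N + t
  lex-< {g} {h} {s} {t} g<h s<N = begin-strict
    g * N + s   <⟨ +-monoʳ-< (g * N) s<N ⟩
    g * N + N   ≡⟨ +-comm (g * N) N ⟩
    suc g * N   ≤⟨ *-monoˡ-≤ N g<h ⟩
    h * N       ≤⟨ m≤m+n (h * N) t ⟩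
    h * N + t   ∎
    where open ≤-Reasoning

  lex-injective : ∀ {g h s t} → s < N → t < N → g * N + s ≡ h * N + t → g ≡ h × s ≡ t
  lex-injective {g} {h} {s} {t} s<N t<N eq with <-cmp g h
  ... | tri< g<h _ _ = contradiction eq (<⇒≢ (lex-< g<h s<N))
  ... | tri> _ _ h<g = contradiction (sym eq) (<⇒≢ (lex-< h<g t<N))
  ... | tri≈ _ refl _ = refl , +-cancelˡ-≡ (g * N) s t eq

  lex-mono : ∀ {g h s t} → g ≤ h → (g ≡ h → s < t) → s < N → g * N + s < h * N + t
  lex-mono {g} g≤h s<t s<N with m≤n⇒m<n∨m≡n g≤h
  ... | inj₁ g<h  = lex-< g<h s<N
  ... | inj₂ refl = +-monoʳ-< (g * N) (s<t refl)

  lex-≤⇔ : ∀ {g h t} → t < N → g * N ≤ h * N + t ⇔ g ≤ h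
  lex-≤⇔ {g} {h} {t} t<N = mk⇔ to λ g≤h → ≤-trans (*-monoˡ-≤ N g≤h) (m≤m+n (h * N) t)
    where
    to : g * N ≤ h * N + t → g ≤ h
    to gN≤ with g ≤? h
    ... | yes g≤h = g≤h
    ... | no  g≰h = contradiction gN≤
      (<⇒≱ (subst (h * N + t <_) (+-identityʳ (g * N)) (lex-< (≰⇒> g≰h) t<N)))

  lex-<⇔ : ∀ {g h t} → t < N → h * N + t < g * N ⇔ h < g
  lex-<⇔ {g} {h} {t} t<N = mk⇔
    (λ lt → ≰⇒> λ g≤h → <⇒≱ lt (Equivalence.from (lex-≤⇔ t<N) g≤h))
    (λ h<g → subst (h * N + t <_) (+-identityʳ (g * N)) (lex-< h<g t<N))

range-subst : ∀ {a a' x x' b b'} → a ≡ a' → x ≡ x' → b ≡ b' → a ≤ x × x < b → a' ≤ x' × x' < b'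
range-subst refl refl refl = id

module Construction {p : ℕ} (p≥1 : 1 ≤ p) {S : Subset n} {m M i : Fin n}
  (m-min : ∀ j → j ∈ S → toℕ m ≤ toℕ j) (M-max : ∀ j → j ∈ S → toℕ j ≤ toℕ M)
  (interval : IntervalCond p m M S) (i∈S : i ∈ S) (i-bound : ∀ l → l ∈ S → toℕ l < toℕ i + p) where

  -- outside S, a destination l with l + p ≤ M must precede v_M ∈ S (slot 0); the others follow S (slot 2)
  slot : Fin n → ℕ
  slot d with d ∈? S | toℕ d + p ≤? toℕ M
  ... | yes _ | _     = 1
  ... | no _  | yes _ = 0
  ... | no _  | no _  = 2

  slot≡1⇒∈ : ∀ {d} → slot d ≡ 1 → d ∈ S
  slot≡1⇒∈ {d} eq with d ∈? S | toℕ d + p ≤? toℕ M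
  ... | yes d∈S | _ = d∈S
  ... | no _    | yes _ with () ← eq
  ... | no _    | no _  with () ← eq

  ∈⇒slot≡1 : ∀ {d} → d ∈ S → slot d ≡ 1
  ∈⇒slot≡1 {d} d∈S with d ∈? S
  ... | yes _  = refl
  ... | no d∉S = contradiction d∈S d∉S

  slot-mono : ∀ x y → toℕ x + p ≤ toℕ y → slot x ≤ slot y
  slot-mono x y x+p≤y with x ∈? S | toℕ x + p ≤? toℕ M | y ∈? S | toℕ y + p ≤? toℕ M
  ... | yes _   | _       | yes _   | _       = ≤-refl
  ... | yes x∈S | _       | no  y∉S | yes y+p≤M =
    contradiction (interval y (≤-trans (+-monoˡ-≤ p (m-min x x∈S)) x+p≤y) y+p≤M) y∉S
  ... | yes _   | _       | no _    | no _    = s≤s z≤n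
  ... | no _    | yes _   | _       | _       = z≤n
  ... | no _    | no x+p≰M | yes y∈S | _      = contradiction (≤-trans x+p≤y (M-max y y∈S)) x+p≰M
  ... | no _    | no x+p≰M | no _   | yes y+p≤M =
    contradiction (≤-trans x+p≤y (≤-trans (m≤m+n (toℕ y) p) y+p≤M)) x+p≰M
  ... | no _    | no _    | no _    | no _    = ≤-refl

  -- within a slot the index order is kept, except that i moves to the end
  offset : Fin n → ℕ
  offset d with d ≟ i
  ... | yes _ = n
  ... | no _  = toℕ d

  offset≤n : ∀ d → offset d ≤ n
  offset≤n d with d ≟ i
  ... | yes _ = ≤-refl
  ... | no _  = <⇒≤ (toℕ<n d)

  offset-i : offset i ≡ n
  offset-i with i ≟ i
  ... | yes _  = refl
  ... | no i≢i = contradiction refl i≢i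

  offset-injective : Injective _≡_ _≡_ offset
  offset-injective {x} {y} eq with x ≟ i | y ≟ i
  ... | yes refl | yes refl = refl
  ... | yes _    | no _     = contradiction (sym eq) (<⇒≢ (toℕ<n y))
  ... | no _     | yes _    = contradiction eq (<⇒≢ (toℕ<n x))
  ... | no _     | no _     = toℕ-injective eq

  offset-mono : ∀ x y → slot x ≡ slot y → toℕ x + p ≤ toℕ y → offset x < offset y
  offset-mono x y slot≡ x+p≤y with x ≟ i | y ≟ i
  ... | yes refl | _     = contradiction x+p≤y (<⇒≱ (i-bound y (slot≡1⇒∈ (trans (sym slot≡) (∈⇒slot≡1 i∈S)))))
  ... | no _     | yes _ = toℕ<n x
  ... | no _     | no _  = <-≤-trans (m<m+n (toℕ x) p≥1) x+p≤y

  N : ℕ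
  N = suc n

  key : Fin n → ℕ
  key d = slot d * N + offset d

  key-injective : Injective _≡_ _≡_ key
  key-injective {x} {y} eq =
    offset-injective (proj₂ (lex-injective {g = slot x} {h = slot y} (s≤s (offset≤n x)) (s≤s (offset≤n y)) eq))

  key-respects : ∀ x y → toℕ x + p ≤ toℕ y → key x < key y
  key-respects x y x+p≤y =
    lex-mono (slot-mono x y x+p≤y) (λ slot≡ → offset-mono x y slot≡ x+p≤y) (s≤s (offset≤n x))

  open SortByKey key key-injective

  rank∈range⇔∈ : ∀ {d} → (below (1 * N) ≤ rank d × rank d < below (2 * N)) ⇔ d ∈ S
  rank∈range⇔∈ {d} = begin
    (below (1 * N) ≤ rank d × rank d < below (2 * N)) ∼⟨ below≤rank⇔ {d} ×-⇔ rank<below⇔ {d} ⟩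
    (1 * N ≤ key d × key d < 2 * N)                   ∼⟨ lex-≤⇔ offset<N ×-⇔ lex-<⇔ offset<N ⟩
    (1 ≤ slot d × slot d < 2)                         ∼⟨ mk⇔ (λ (1≤g , g<2) → ≤-antisym (≤-pred g<2) 1≤g)
                                                             (λ g≡1 → ≤-reflexive (sym g≡1) , s≤s (≤-reflexive g≡1)) ⟩
    slot d ≡ 1                                        ∼⟨ mk⇔ slot≡1⇒∈ ∈⇒slot≡1 ⟩
    d ∈ S                                             ∎
    where
    open EquationalReasoning
    offset<N : offset d < N
    offset<N = s≤s (offset≤n d)

  open Enumeration σ

  pos≡rank : ∀ d → pos d ≡ rank d
  pos≡rank = toℕ-toRank

  bsOrder : BSOrder p σ
  bsOrder x y x+p≤y = subst₂ _<_ (sym (pos≡rank x)) (sym (pos≡rank y)) (rank<below {x} (key-respects x y x+p≤y))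

  key≤key-i : ∀ {e} → e ∈ S → key e ≤ key i
  key≤key-i {e} e∈S rewrite ∈⇒slot≡1 e∈S | ∈⇒slot≡1 i∈S | offset-i = +-monoʳ-≤ (1 * N) (offset≤n e)

  module _ (pre mid post : List (Fin n)) (split : enum ≡ pre ++ mid ++ post)
           (|pre| : length pre ≡ below (1 * N)) (|pre|+|mid| : length pre + length mid ≡ below (2 * N)) where

    open Segment {pre} {mid} {post} split

    mid≈S : SeqSet mid S
    mid≈S d =
      (λ d∈mid → Equivalence.to (rank∈range⇔∈ {d})
        (range-subst |pre| (pos≡rank d) |pre|+|mid| (∈-mid⇒pos∈range d∈mid))) ,
      (λ d∈S → uncurry pos∈range⇒∈-mid
        (range-subst (sym |pre|) (sym (pos≡rank d)) (sym |pre|+|mid|) (Equivalence.from (rank∈range⇔∈ {d}) d∈S)))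

    last-mid≡i : last mid ≡ just i
    last-mid≡i = maximal⇒last-mid (proj₂ (mid≈S i) i∈S) λ e e∈mid →
      subst₂ _≤_ (sym (pos≡rank e)) (sym (pos≡rank i)) (below-mono (key≤key-i (proj₁ (mid≈S e) e∈mid)))

  segmentEndingIn-i : SpansSegmentEndingIn p S i
  segmentEndingIn-i = segmentOf (splitRange enum (below-mono (*-monoˡ-≤ N {1} {2} (s≤s z≤n)))
    (subst (below (2 * N) ≤_) (sym (length-tabulate _)) (below≤n (2 * N))))
    where
    segmentOf : ∃[ pre ] ∃[ mid ] ∃[ post ] (enum ≡ pre ++ mid ++ post × length pre ≡ below (1 * N) ×
                                             length pre + length mid ≡ below (2 * N)) →
                SpansSegmentEndingIn p S i
    segmentOf (pre , mid , post , split , |pre| , |pre|+|mid|) =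
      mid , record { σ = σ ; bsOrder = bsOrder ; pre = pre ; post = post ; split = split } ,
      mid≈S pre mid post split |pre| |pre|+|mid| , last-mid≡i pre mid post split |pre| |pre|+|mid|

open Construction using (segmentEndingIn-i)

module _ {p : ℕ} (p≥1 : 1 ≤ p) {S : Subset n} {m M : Fin n} (isMin : IsMinOf m S) (isMax : IsMaxOf M S) where

  spansSegment⇔intervalCond : SpansSegment p S ⇔ IntervalCond p m M S
  spansSegment⇔intervalCond = mk⇔
    (λ (s , seg , s≈S) → segment⇒intervalCond seg s≈S (proj₁ isMin) (proj₁ isMax))
    (λ interval →
      let s , seg , s≈S , _ = segmentEndingIn-i p≥1 (proj₂ isMin) (proj₂ isMax) interval (proj₁ isMax) M-bound
      in s , seg , s≈S)
    where
    M-bound : ∀ l → l ∈ S → toℕ l < toℕ M + p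
    M-bound l l∈S = ≤-<-trans (proj₂ isMax l l∈S) (m<m+n (toℕ M) p≥1)

  spansSegmentEndingIn⇔criterion : ∀ {i} → i ∈ S →
    SpansSegmentEndingIn p S i ⇔ (IntervalCond p m M S × ∀ l → l ∈ S → toℕ l < toℕ i + p)
  spansSegmentEndingIn⇔criterion i∈S = mk⇔
    (λ (s , seg , s≈S , last≡i) →
      segment⇒intervalCond seg s≈S (proj₁ isMin) (proj₁ isMax) , segment⇒lastBound seg s≈S last≡i)
    (λ (interval , i-bound) → segmentEndingIn-i p≥1 (proj₂ isMin) (proj₂ isMax) interval i∈S i-bound)

proposition5 : (n p : ℕ) → 1 ≤ p → (R : Set) → (w₀ wₜ w : R) →
    (S : Subset n) → Nonempty S → (v : Fin n ⊎ R) → InSOrR S v →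
    (m M : Fin n) → IsMinOf m S → IsMaxOf M S →
    ValidState p w₀ wₜ w S v ⇔ Criterion p m M S v
proposition5 n p p≥1 R w₀ wₜ w S S≢∅ (inj₂ w') _ m M isMin isMax =
  spansSegment⇔intervalCond p≥1 isMin isMax ⇔-∘ validState⇔spansSegment S≢∅
proposition5 n p p≥1 R w₀ wₜ w S _ (inj₁ i) i∈S m M isMin isMax =
  spansSegmentEndingIn⇔criterion p≥1 isMin isMax i∈S ⇔-∘ validState⇔spansSegmentEndingIn
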